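{- Let $G$ be a tournament which is $T_5$-free and $U_5$-free, let $v\in V(G)$, and let $B=\{u\in V(G): u\rightarrow v\}$ and $A=\{u\in V(G): v\rightarrow u\}$. Suppose $C=\{x,y,z\}\subseteq V(G)\setminus\{v\}$ is a cyclic triangle. Then: (a) If $|C\cap A|=1$ and there is $u\in V(G)\setminus\{v\}$ with $u\rightarrow c$ for all $c\in C$, then $u\in B$. (b) If $|C\cap A|=2$ and there is $u\in V(G)\setminus\{v\}$ with $c\rightarrow u$ for all $c\in C$, then $u\in A$. If in addition there is $x'\in V(G)\setminus\{v,x,y,z\}$ such that $C'=\{x',y,z\}$ is a cyclic triangle and $x\rightarrow x'$, then: (c) If $|C\cap A|>0$, then $|C'\cap A|>0$. (d) If $|C\cap A|=3$, then $|C'\cap A|=3$. (e) If $y\rightarrow z$, $y\in B$ and $z\in A$, then $x$ and $x'$ are either both in $B$ or both in $A$.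
   Context: A tournament is a finite loopless directed graph in which for any two distinct vertices $u,v$ there is exactly one edge between them; write $u\rightarrow v$ for the edge from $u$ to $v$. For tournaments $G,H$, $G$ is $H$-free if no induced subtournament of $G$ is isomorphic to $H$. A cyclic triangle is a set $\{a,b,c\}$ of three distinct vertices with $a\rightarrow b\rightarrow c\rightarrow a$. $T_5$ is the tournament on $v_1,\dots,v_5$ with $v_i\rightarrow v_j$ iff $j-i\equiv 1,2\pmod 5$. $U_5$ is the tournament on $v_1,\dots,v_5$ with $v_2\rightarrow v_1$, and $v_i\rightarrow v_j$ whenever $j-i\equiv 1,2\pmod 5$ and $\{i,j\}\neq\{1,2\}$. -}

module Defs where

open import Data.Nat using (ℕ; zero; suc; _+_; _∸_; _%_)
open import Data.Fin using (Fin; toℕ)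
open import Data.Bool using (Bool; true; false; _∧_; _∨_; not; T; if_then_else_)
open import Data.Product using (Σ; _×_; _,_)
open import Data.Sum using (_⊎_)
open import Relation.Nullary using (¬_; Dec)
open import Relation.Nullary.Decidable using (⌊_⌋)
open import Relation.Binary using (Decidable)
open import Relation.Binary.PropositionalEquality using (_≡_; _≢_)
open import Function.Definitions using (Injective)
open import Function.Bundles using (_⇔_)

-- A tournament on the vertex set Fin n.  E u v means u → v.
-- Decidability of the edge relation is included (the graph is finite).
record Tournament (n : ℕ) : Set₁ where
  field
    E      : Fin n → Fin n → Set
    E?     : Decidable E
    irrefl : ∀ u → ¬ E u u
    asym   : ∀ u v → E u v → ¬ E v u
    total  : ∀ u v → u ≢ v → E u v ⊎ E v u

-- Edge relations of the two 5-vertex tournaments, with vertices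
-- v₁,…,v₅ represented by Fin 5 elements 0,…,4.
diff5 : Fin 5 → Fin 5 → ℕ
diff5 i j = (toℕ j + 5 ∸ toℕ i) % 5

isOneOrTwo : ℕ → Bool
isOneOrTwo 1 = true
isOneOrTwo 2 = true
isOneOrTwo _ = false

isZero : ℕ → Bool
isZero 0 = true
isZero _ = false

isOne : ℕ → Bool
isOne 1 = true
isOne _ = false

T5ᵇ : Fin 5 → Fin 5 → Bool
T5ᵇ i j = isOneOrTwo (diff5 i j)

pair12 : Fin 5 → Fin 5 → Bool
pair12 i j = (isZero (toℕ i) ∧ isOne (toℕ j)) ∨ (isOne (toℕ i) ∧ isZero (toℕ j))

U5ᵇ : Fin 5 → Fin 5 → Bool
U5ᵇ i j = (isOne (toℕ i) ∧ isZero (toℕ j)) ∨ (T5ᵇ i j ∧ not (pair12 i j))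

T5 : Fin 5 → Fin 5 → Set
T5 i j = T (T5ᵇ i j)

U5 : Fin 5 → Fin 5 → Set
U5 i j = T (U5ᵇ i j)

Contains5 : ∀ {n} → Tournament n → (Fin 5 → Fin 5 → Set) → Set
Contains5 G H = Σ (Fin 5 → Fin _) λ f →
  Injective _≡_ _≡_ f × (∀ i j → (Tournament.E G (f i) (f j) ⇔ H i j))

Free5 : ∀ {n} → Tournament n → (Fin 5 → Fin 5 → Set) → Set
Free5 G H = ¬ Contains5 G H

-- {a,b,c} is a cyclic triangle (in one of the two cyclic orientations;
-- distinctness follows from irreflexivity).
CyclicTriangle : ∀ {n} → Tournament n → Fin n → Fin n → Fin n → Set
CyclicTriangle G a b c =
  (E a b × E b c × E c a) ⊎ (E a c × E c b × E b a)
  where open Tournament G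

InA : ∀ {n} → Tournament n → Fin n → Fin n → Set
InA G v u = Tournament.E G v u

InB : ∀ {n} → Tournament n → Fin n → Fin n → Set
InB G v u = Tournament.E G u v

-- |{a,b,c} ∩ A| for distinct a,b,c
countA : ∀ {n} → Tournament n → Fin n → Fin n → Fin n → Fin n → ℕ
countA G v a b c = ind a + ind b + ind c
  where
    ind : Fin _ → ℕ
    ind u = if ⌊ Tournament.E? G v u ⌋ then 1 else 0

module Submission where

-- Every part speaks about five vertices: v, x, y, z and a fifth one (u or x′).
-- So it suffices that among the 2 ^ 10 tournaments on five labelled vertices,
-- each one satisfying the hypotheses of a part but violating its conclusion is
-- isomorphic to T₅ or U₅; this is checked by evaluation, and such an induced
-- subtournament cannot occur in G.

open import Defs
open import Data.Bool using (Bool; true; false; not; T; if_then_else_)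
open import Data.Bool.Properties using () renaming (_≟_ to _≟ᵇ_)
open import Data.Empty using (⊥-elim)
open import Data.Fin using (Fin; zero; suc; #_)
open import Data.Fin.Properties using (any?; all?) renaming (_≟_ to _≟ᶠ_)
open import Data.Nat using (ℕ; zero; suc; _+_; _<_)
open import Data.Nat.Properties using (_≟_; _<?_)
open import Data.Product using (∃; _×_; _,_; proj₁; proj₂)
import Data.Product as Product
open import Data.Sum using (_⊎_; inj₁; inj₂; [_,_])
import Data.Sum as Sum
open import Data.Unit using (⊤; tt)
open import Data.Vec using (Vec; []; _∷_; lookup; map)
open import Data.Vec.Properties using (lookup-map)
open import Data.Vec.Relation.Unary.All using ([]; _∷_)
open import Data.Vec.Relation.Unary.All.Properties using (lookup⁺)
open import Data.Vec.Relation.Unary.AllPairs using (AllPairs; []; _∷_)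
open import Function using (id; _∘_; const)
open import Function.Bundles using (_⇔_; mk⇔; Equivalence)
open import Function.Definitions using (Injective)
open import Relation.Nullary using (Dec; yes; no; ¬?; contradiction)
open import Relation.Nullary.Decidable
  using (⌊_⌋; map′; _×-dec_; _⊎-dec_; _→-dec_; T?; from-yes; toWitness; fromWitness)
open import Relation.Binary.PropositionalEquality using (_≡_; _≢_; refl; sym; ≢-sym)

Table : ℕ → Set
Table k = Fin k → Fin k → Bool

-- A tournament on Fin (suc k) is coded by the out-neighbourhood of 0 in
-- 1 … k followed by the code of the tournament on 1 … k.
Code : ℕ → Set
Code zero    = ⊤
Code (suc k) = Vec Bool k × Code k

table : ∀ {k} → Code k → Table k
table (out , c) zero    zero    = false
table (out , c) zero    (suc j) = lookup out j
table (out , c) (suc i) zero    = not (lookup out i)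
table (out , c) (suc i) (suc j) = table c i j

all-Bool? : {P : Bool → Set} → (∀ b → Dec (P b)) → Dec (∀ b → P b)
all-Bool? P? = map′ (λ { (p , q) true → p ; (p , q) false → q }) (λ p → p true , p false)
  (P? true ×-dec P? false)

all-Vec? : ∀ {k} {P : Vec Bool k → Set} → (∀ v → Dec (P v)) → Dec (∀ v → P v)
all-Vec? {zero}  P? = map′ (λ { p [] → p }) (λ p → p []) (P? [])
all-Vec? {suc k} P? = map′ (λ { p (b ∷ v) → p b v }) (λ p b v → p (b ∷ v))
  (all-Bool? λ b → all-Vec? λ v → P? (b ∷ v))

all-Code? : ∀ {k} {P : Code k → Set} → (∀ c → Dec (P c)) → Dec (∀ c → P c)
all-Code? {zero}  P? = map′ (λ p _ → p) (λ p → p tt) (P? tt)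
all-Code? {suc k} P? = map′ (λ { p (o , c) → p o c }) (λ p o c → p (o , c))
  (all-Vec? λ o → all-Code? λ c → P? (o , c))

IsTournament : ∀ {k} → Table k → Set
IsTournament H = ∀ i j → i ≢ j → T (H i j) ⊎ T (H j i)

isTournament? : ∀ {k} (H : Table k) → Dec (IsTournament H)
isTournament? H = all? λ i → all? λ j → ¬? (i ≟ᶠ j) →-dec (T? (H i j) ⊎-dec T? (H j i))

T5-isTournament : IsTournament T5ᵇ
T5-isTournament = from-yes (isTournament? T5ᵇ)

U5-isTournament : IsTournament U5ᵇ
U5-isTournament = from-yes (isTournament? U5ᵇ)

lower : ∀ {k} → Table (suc k) → Table k
lower H i j = H (suc i) (suc j)

Matches : ∀ {m k} → Table m → Table k → Vec (Fin m) k → Set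
Matches M H []      = ⊤
Matches M H (a ∷ σ) = M a a ≡ H zero zero
  × (∀ j → M a (lookup σ j) ≡ H zero (suc j) × M (lookup σ j) a ≡ H (suc j) zero)
  × Matches M (lower H) σ

matches⇒lookup : ∀ {m k} {M : Table m} {H : Table k} {σ} → Matches M H σ →
  ∀ i j → M (lookup σ i) (lookup σ j) ≡ H i j
matches⇒lookup {σ = _ ∷ _} (loop , _    , _) zero    zero    = loop
matches⇒lookup {σ = _ ∷ _} (_    , edge , _) zero    (suc j) = proj₁ (edge j)
matches⇒lookup {σ = _ ∷ _} (_    , edge , _) (suc i) zero    = proj₂ (edge i)
matches⇒lookup {σ = _ ∷ _} (_    , _ , rest) (suc i) (suc j) = matches⇒lookup rest i j

-- A match of lower H is found first and only then extended, so partial matches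
-- are discarded as soon as they fail; scanning all m ^ k maps is too slow to evaluate.
match? : ∀ {m k} (M : Table m) (H : Table k) {Q : Vec (Fin m) k → Set} →
  (∀ σ → Dec (Q σ)) → Dec (∃ λ σ → Matches M H σ × Q σ)
match? {k = zero}  M H Q? = map′ (λ q → [] , tt , q) (λ { ([] , _ , q) → q }) (Q? [])
match? {k = suc k} M H Q? = map′
  (λ { (σ , m , a , (l , e) , q) → a ∷ σ , (l , e , m) , q })
  (λ { (a ∷ σ , (l , e , m) , q) → σ , m , a , (l , e) , q })
  (match? M (lower H) λ σ → any? λ a →
    ((M a a ≟ᵇ H zero zero) ×-dec
     (all? λ j → (M a (lookup σ j) ≟ᵇ H zero (suc j)) ×-dec (M (lookup σ j) a ≟ᵇ H (suc j) zero)))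
    ×-dec Q? (a ∷ σ))

_≅_ : ∀ {k} → Table k → Table k → Set
M ≅ H = ∃ (Matches M H)

_≅?_ : ∀ {k} (M H : Table k) → Dec (M ≅ H)
M ≅? H = map′ (λ { (σ , m , _) → σ , m }) (λ { (σ , m) → σ , m , tt }) (match? M H λ _ → yes tt)

HoldsOutsideT5U5 : (Table 5 → Set) → Set
HoldsOutsideT5U5 P = ∀ c → P (table c) ⊎ table c ≅ T5ᵇ ⊎ table c ≅ U5ᵇ

holdsOutsideT5U5? : {P : Table 5 → Set} → (∀ M → Dec (P M)) → Dec (HoldsOutsideT5U5 P)
holdsOutsideT5U5? P? = all-Code? λ c → P? (table c) ⊎-dec table c ≅? T5ᵇ ⊎-dec table c ≅? U5ᵇ

Cyclic : ∀ {k} → Table k → Fin k → Fin k → Fin k → Set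
Cyclic M a b c = (T (M a b) × T (M b c) × T (M c a)) ⊎ (T (M a c) × T (M c b) × T (M b a))

cyclic? : ∀ {k} (M : Table k) a b c → Dec (Cyclic M a b c)
cyclic? M a b c = (T? (M a b) ×-dec T? (M b c) ×-dec T? (M c a))
             ⊎-dec (T? (M a c) ×-dec T? (M c b) ×-dec T? (M b a))

outCount : ∀ {k} → Table k → Fin k → Fin k → Fin k → Fin k → ℕ
outCount M v a b c = (if M v a then 1 else 0) + (if M v b then 1 else 0) + (if M v c then 1 else 0)

-- Vertex # 0 plays v, vertices # 1, # 2, # 3 play x, y, z, and # 4 plays u or x′.
DominatorInB : Table 5 → Set
DominatorInB M = Cyclic M (# 1) (# 2) (# 3) → outCount M (# 0) (# 1) (# 2) (# 3) ≡ 1 →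
  T (M (# 4) (# 1)) → T (M (# 4) (# 2)) → T (M (# 4) (# 3)) → T (M (# 4) (# 0))

dominatorInB? : ∀ M → Dec (DominatorInB M)
dominatorInB? M = cyclic? M (# 1) (# 2) (# 3) →-dec outCount M (# 0) (# 1) (# 2) (# 3) ≟ 1 →-dec
  T? (M (# 4) (# 1)) →-dec T? (M (# 4) (# 2)) →-dec T? (M (# 4) (# 3)) →-dec T? (M (# 4) (# 0))

DominatedInA : Table 5 → Set
DominatedInA M = Cyclic M (# 1) (# 2) (# 3) → outCount M (# 0) (# 1) (# 2) (# 3) ≡ 2 →
  T (M (# 1) (# 4)) → T (M (# 2) (# 4)) → T (M (# 3) (# 4)) → T (M (# 0) (# 4))

dominatedInA? : ∀ M → Dec (DominatedInA M)
dominatedInA? M = cyclic? M (# 1) (# 2) (# 3) →-dec outCount M (# 0) (# 1) (# 2) (# 3) ≟ 2 →-dec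
  T? (M (# 1) (# 4)) →-dec T? (M (# 2) (# 4)) →-dec T? (M (# 3) (# 4)) →-dec T? (M (# 0) (# 4))

AdjacentTriangles : Table 5 → Set
AdjacentTriangles M = Cyclic M (# 1) (# 2) (# 3) × Cyclic M (# 4) (# 2) (# 3) × T (M (# 1) (# 4))

adjacentTriangles? : ∀ M → Dec (AdjacentTriangles M)
adjacentTriangles? M = cyclic? M (# 1) (# 2) (# 3) ×-dec cyclic? M (# 4) (# 2) (# 3) ×-dec T? (M (# 1) (# 4))

MeetingAPersists : Table 5 → Set
MeetingAPersists M = AdjacentTriangles M →
  0 < outCount M (# 0) (# 1) (# 2) (# 3) → 0 < outCount M (# 0) (# 4) (# 2) (# 3)

meetingAPersists? : ∀ M → Dec (MeetingAPersists M)
meetingAPersists? M = adjacentTriangles? M →-dec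
  0 <? outCount M (# 0) (# 1) (# 2) (# 3) →-dec 0 <? outCount M (# 0) (# 4) (# 2) (# 3)

InsideAPersists : Table 5 → Set
InsideAPersists M = AdjacentTriangles M →
  outCount M (# 0) (# 1) (# 2) (# 3) ≡ 3 → outCount M (# 0) (# 4) (# 2) (# 3) ≡ 3

insideAPersists? : ∀ M → Dec (InsideAPersists M)
insideAPersists? M = adjacentTriangles? M →-dec
  outCount M (# 0) (# 1) (# 2) (# 3) ≟ 3 →-dec outCount M (# 0) (# 4) (# 2) (# 3) ≟ 3

EndsOnSameSide : Table 5 → Set
EndsOnSameSide M = AdjacentTriangles M → T (M (# 2) (# 3)) → T (M (# 2) (# 0)) → T (M (# 0) (# 3)) →
  (T (M (# 1) (# 0)) × T (M (# 4) (# 0))) ⊎ (T (M (# 0) (# 1)) × T (M (# 0) (# 4)))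

endsOnSameSide? : ∀ M → Dec (EndsOnSameSide M)
endsOnSameSide? M =
  adjacentTriangles? M →-dec T? (M (# 2) (# 3)) →-dec T? (M (# 2) (# 0)) →-dec T? (M (# 0) (# 3)) →-dec
  ((T? (M (# 1) (# 0)) ×-dec T? (M (# 4) (# 0))) ⊎-dec (T? (M (# 0) (# 1)) ×-dec T? (M (# 0) (# 4))))

dominatorInB-outsideT5U5 : HoldsOutsideT5U5 DominatorInB
dominatorInB-outsideT5U5 = from-yes (holdsOutsideT5U5? dominatorInB?)

dominatedInA-outsideT5U5 : HoldsOutsideT5U5 DominatedInA
dominatedInA-outsideT5U5 = from-yes (holdsOutsideT5U5? dominatedInA?)

meetingAPersists-outsideT5U5 : HoldsOutsideT5U5 MeetingAPersists
meetingAPersists-outsideT5U5 = from-yes (holdsOutsideT5U5? meetingAPersists?)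

insideAPersists-outsideT5U5 : HoldsOutsideT5U5 InsideAPersists
insideAPersists-outsideT5U5 = from-yes (holdsOutsideT5U5? insideAPersists?)

endsOnSameSide-outsideT5U5 : HoldsOutsideT5U5 EndsOnSameSide
endsOnSameSide-outsideT5U5 = from-yes (holdsOutsideT5U5? endsOnSameSide?)

module _ {n} (G : Tournament n) where
  open Tournament G

  edge⇒≢ : ∀ {a b} → E a b → a ≢ b
  edge⇒≢ {a} a→a refl = irrefl a a→a

  edge⇔T : ∀ a b → E a b ⇔ T ⌊ E? a b ⌋
  edge⇔T a b = mk⇔ fromWitness toWitness

  reverse-edge⇔T : ∀ {a b} → a ≢ b → E b a ⇔ T (not ⌊ E? a b ⌋)
  reverse-edge⇔T {a} {b} a≢b with E? a b
  ... | yes a→b = mk⇔ (asym a b a→b) λ ()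
  ... | no ¬a→b = mk⇔ (const tt) (λ _ → [ ⊥-elim ∘ ¬a→b , id ] (total a b a≢b))

  cyclic⇒distinct : ∀ {a b c} → CyclicTriangle G a b c → a ≢ b × a ≢ c × b ≢ c
  cyclic⇒distinct (inj₁ (a→b , b→c , c→a)) =
    edge⇒≢ a→b , ≢-sym (edge⇒≢ c→a) , edge⇒≢ b→c
  cyclic⇒distinct (inj₂ (a→c , c→b , b→a)) =
    ≢-sym (edge⇒≢ b→a) , edge⇒≢ a→c , ≢-sym (edge⇒≢ c→b)

  induced : ∀ {k} → Vec (Fin n) k → Code k
  induced []       = tt
  induced (a ∷ as) = map (λ b → ⌊ E? a b ⌋) as , induced as

  induced-edge : ∀ {k} {vs : Vec (Fin n) k} → AllPairs _≢_ vs → ∀ i j →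
    E (lookup vs i) (lookup vs j) ⇔ T (table (induced vs) i j)
  induced-edge {vs = a ∷ _} _ zero zero = mk⇔ (irrefl a) λ ()
  induced-edge {vs = a ∷ as} _ zero (suc j)
    rewrite lookup-map j (λ b → ⌊ E? a b ⌋) as = edge⇔T a (lookup as j)
  induced-edge {vs = a ∷ as} (a≢as ∷ _) (suc i) zero
    rewrite lookup-map i (λ b → ⌊ E? a b ⌋) as = reverse-edge⇔T (lookup⁺ a≢as i)
  induced-edge (_ ∷ distinct) (suc i) (suc j) = induced-edge distinct i j

  contains-≅ : ∀ {vs : Vec (Fin n) 5} {H} → AllPairs _≢_ vs → IsTournament H →
    table (induced vs) ≅ H → Contains5 G (λ i j → T (H i j))
  contains-≅ {vs} {H} distinct H-tournament (σ , σ-matches) = f , f-injective , f-edge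
    where
    f : Fin 5 → Fin n
    f i = lookup vs (lookup σ i)

    f-edge : ∀ i j → E (f i) (f j) ⇔ T (H i j)
    f-edge i j rewrite sym (matches⇒lookup σ-matches i j) =
      induced-edge distinct (lookup σ i) (lookup σ j)

    f-injective : Injective _≡_ _≡_ f
    f-injective {i} {j} fi≡fj with i ≟ᶠ j
    ... | yes i≡j = i≡j
    ... | no i≢j  = contradiction fi≡fj
      ([ edge⇒≢ ∘ Equivalence.from (f-edge i j) , ≢-sym ∘ edge⇒≢ ∘ Equivalence.from (f-edge j i) ]
        (H-tournament i j i≢j))

  holdsOutsideT5U5⇒induced : Free5 G T5 → Free5 G U5 → ∀ P {vs : Vec (Fin n) 5} →
    AllPairs _≢_ vs → HoldsOutsideT5U5 P → P (table (induced vs))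
  holdsOutsideT5U5⇒induced T5-free U5-free P {vs} distinct holds with holds (induced vs)
  ... | inj₁ p            = p
  ... | inj₂ (inj₁ ≅T5) = contradiction (contains-≅ distinct T5-isTournament ≅T5) T5-free
  ... | inj₂ (inj₂ ≅U5) = contradiction (contains-≅ distinct U5-isTournament ≅U5) U5-free

  induced-cyclic : ∀ {vs : Vec (Fin n) 5} → AllPairs _≢_ vs → ∀ a b c →
    CyclicTriangle G (lookup vs a) (lookup vs b) (lookup vs c) → Cyclic (table (induced vs)) a b c
  induced-cyclic distinct a b c = Sum.map
    (λ { (a→b , b→c , c→a) → to a b a→b , to b c b→c , to c a c→a })
    (λ { (a→c , c→b , b→a) → to a c a→c , to c b c→b , to b a b→a })
    where
    to : ∀ i j → E _ _ → T _
    to i j = Equivalence.to (induced-edge distinct i j)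

module Configuration {n} (G : Tournament n) (T5-free : Free5 G T5) (U5-free : Free5 G U5)
  {v x y z : Fin n} (x≢v : x ≢ v) (y≢v : y ≢ v) (z≢v : z ≢ v) (xyz : CyclicTriangle G x y z)
  where
  open Tournament G

  module WithFifth {w : Fin n} (w≢v : w ≢ v) (w≢x : w ≢ x) (w≢y : w ≢ y) (w≢z : w ≢ z) where
    vertices : Vec (Fin n) 5
    vertices = v ∷ x ∷ y ∷ z ∷ w ∷ []

    distinct : AllPairs _≢_ vertices
    distinct = let x≢y , x≢z , y≢z = cyclic⇒distinct G xyz in
      (≢-sym x≢v ∷ ≢-sym y≢v ∷ ≢-sym z≢v ∷ ≢-sym w≢v ∷ []) ∷ (x≢y ∷ x≢z ∷ ≢-sym w≢x ∷ []) ∷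
      (y≢z ∷ ≢-sym w≢y ∷ []) ∷ (≢-sym w≢z ∷ []) ∷ [] ∷ []

    M : Table 5
    M = table (induced G vertices)

    to : ∀ i j → E (lookup vertices i) (lookup vertices j) → T (M i j)
    to i j = Equivalence.to (induced-edge G distinct i j)

    from : ∀ i j → T (M i j) → E (lookup vertices i) (lookup vertices j)
    from i j = Equivalence.from (induced-edge G distinct i j)

    holds : ∀ P → HoldsOutsideT5U5 P → P M
    holds P = holdsOutsideT5U5⇒induced G T5-free U5-free P distinct

    xyz-cyclic : Cyclic M (# 1) (# 2) (# 3)
    xyz-cyclic = induced-cyclic G distinct (# 1) (# 2) (# 3) xyz

  dominator-in-B : countA G v x y z ≡ 1 → (u : Fin n) → u ≢ v → E u x → E u y → E u z → InB G v u
  dominator-in-B one u u≢v u→x u→y u→z = from (# 4) (# 0)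
    (holds DominatorInB dominatorInB-outsideT5U5 xyz-cyclic one
      (to (# 4) (# 1) u→x) (to (# 4) (# 2) u→y) (to (# 4) (# 3) u→z))
    where open WithFifth u≢v (edge⇒≢ G u→x) (edge⇒≢ G u→y) (edge⇒≢ G u→z)

  dominated-in-A : countA G v x y z ≡ 2 → (u : Fin n) → u ≢ v → E x u → E y u → E z u → InA G v u
  dominated-in-A two u u≢v x→u y→u z→u = from (# 0) (# 4)
    (holds DominatedInA dominatedInA-outsideT5U5 xyz-cyclic two
      (to (# 1) (# 4) x→u) (to (# 2) (# 4) y→u) (to (# 3) (# 4) z→u))
    where open WithFifth u≢v (≢-sym (edge⇒≢ G x→u)) (≢-sym (edge⇒≢ G y→u)) (≢-sym (edge⇒≢ G z→u))

  module Adjacent {x′ : Fin n} (x′≢v : x′ ≢ v) (x′≢x : x′ ≢ x) (x′≢y : x′ ≢ y) (x′≢z : x′ ≢ z)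
    (x′yz : CyclicTriangle G x′ y z) (x→x′ : E x x′) where
    open WithFifth x′≢v x′≢x x′≢y x′≢z

    adjacent : AdjacentTriangles M
    adjacent = xyz-cyclic , induced-cyclic G distinct (# 4) (# 2) (# 3) x′yz , to (# 1) (# 4) x→x′

    meeting-A-persists : 0 < countA G v x y z → 0 < countA G v x′ y z
    meeting-A-persists = holds MeetingAPersists meetingAPersists-outsideT5U5 adjacent

    inside-A-persists : countA G v x y z ≡ 3 → countA G v x′ y z ≡ 3
    inside-A-persists = holds InsideAPersists insideAPersists-outsideT5U5 adjacent

    ends-on-same-side : E y z → InB G v y → InA G v z →
      (InB G v x × InB G v x′) ⊎ (InA G v x × InA G v x′)
    ends-on-same-side y→z y→v v→z = Sum.map
      (Product.map (from (# 1) (# 0)) (from (# 4) (# 0)))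
      (Product.map (from (# 0) (# 1)) (from (# 0) (# 4)))
      (holds EndsOnSameSide endsOnSameSide-outsideT5U5 adjacent
        (to (# 2) (# 3) y→z) (to (# 2) (# 0) y→v) (to (# 0) (# 3) v→z))

proposition4p3 : ∀ {n} (G : Tournament n) → Free5 G T5 → Free5 G U5 →
    (v x y z : Fin n) → x ≢ v → y ≢ v → z ≢ v → CyclicTriangle G x y z →
    ((countA G v x y z ≡ 1 → (u : Fin n) → u ≢ v →
        Tournament.E G u x → Tournament.E G u y → Tournament.E G u z → InB G v u)
    × (countA G v x y z ≡ 2 → (u : Fin n) → u ≢ v →
        Tournament.E G x u → Tournament.E G y u → Tournament.E G z u → InA G v u)
    × ((x′ : Fin n) → x′ ≢ v → x′ ≢ x → x′ ≢ y → x′ ≢ z →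
        CyclicTriangle G x′ y z → Tournament.E G x x′ →
        ((0 < countA G v x y z → 0 < countA G v x′ y z)
        × (countA G v x y z ≡ 3 → countA G v x′ y z ≡ 3)
        × (Tournament.E G y z → InB G v y → InA G v z →
            (InB G v x × InB G v x′) ⊎ (InA G v x × InA G v x′)))))
proposition4p3 G T5-free U5-free v x y z x≢v y≢v z≢v xyz =
  dominator-in-B , dominated-in-A ,
  λ x′ x′≢v x′≢x x′≢y x′≢z x′yz x→x′ →
    let open Adjacent x′≢v x′≢x x′≢y x′≢z x′yz x→x′ in
    meeting-A-persists , inside-A-persists , ends-on-same-side
  where open Configuration G T5-free U5-free x≢v y≢v z≢v xyz
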